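{- Let $G$ be a graph and let $C$ be a proper cycle in $G$ (a cycle subgraph on at least $3$ vertices). Then \[ I((G,C)\circ 2K_{1};x)=(1+x)^{|C|}\cdot I((G,C)\bigtriangleup K_{1};x), \] where $|C|$ is the number of vertices of $C$.
   Context: All graphs are finite and simple. For a graph $G$, $I(G;x)=\sum_{k\ge0}s_kx^k$ where $s_k$ is the number of independent sets (sets of pairwise non-adjacent vertices) of size $k$. $(G,C)\circ 2K_1$ is obtained from $G$ by adding, for each vertex $v$ of $C$, two new non-adjacent vertices joined only to $v$. $(G,C)\bigtriangleup K_1$ is obtained from $G$ by adding, for each edge $uv$ of $C$ (pair of consecutive vertices on $C$), one new vertex joined exactly to $u$ and $v$. -}

module Defs where

open import Data.Nat using (ℕ; zero; suc; _+_; _*_; _∸_; _≤_; _≡ᵇ_; s≤s; z≤n; >-nonZero)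
open import Data.Nat.Properties using (≤-trans)
open import Data.Nat.DivMod using (_mod_)
open import Data.Bool using (Bool; true; false; _∧_; _∨_; not; if_then_else_)
open import Data.Fin using (Fin; toℕ; splitAt; _≟_)
open import Data.Fin.Subset using (Subset; ∣_∣)
open import Data.Vec using (Vec; []; _∷_; lookup)
open import Data.List using (List; []; _∷_; _++_; map; filterᵇ; length; allFin; upTo)
open import Data.Nat.ListAction using (sum)
open import Data.Bool.ListAction using (and)
open import Data.Sum using (_⊎_; inj₁; inj₂)
open import Relation.Binary.PropositionalEquality using (_≡_)
open import Relation.Nullary.Decidable using (⌊_⌋)
open import Function.Definitions using (Injective)

record Graph : Set where
  field
    n      : ℕ
    adj    : Fin n → Fin n → Bool
    sym    : ∀ u v → adj u v ≡ adj v u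
    irrefl : ∀ v → adj v v ≡ false
open Graph public

-- Polynomials with ℕ coefficients, as coefficient functions
-- (p k = coefficient of x^k)

Poly : Set
Poly = ℕ → ℕ

_*ₚ_ : Poly → Poly → Poly
(p *ₚ q) k = sum (map (λ i → p i * q (k ∸ i)) (upTo (suc k)))

onePoly : Poly
onePoly zero = 1
onePoly (suc _) = 0

onePlusX : Poly
onePlusX zero = 1
onePlusX (suc zero) = 1
onePlusX (suc (suc _)) = 0

_^ₚ_ : Poly → ℕ → Poly
p ^ₚ zero = onePoly
p ^ₚ suc m = p *ₚ (p ^ₚ m)

allSubsets : (m : ℕ) → List (Subset m)
allSubsets zero = [] ∷ []
allSubsets (suc m) = map (true ∷_) (allSubsets m) ++ map (false ∷_) (allSubsets m)

isIndependent : {m : ℕ} → (Fin m → Fin m → Bool) → Subset m → Bool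
isIndependent {m} a S =
  and (map (λ u → and (map (λ v → not (lookup S u ∧ lookup S v ∧ a u v)) (allFin m))) (allFin m))

indepCount : (m : ℕ) → (Fin m → Fin m → Bool) → ℕ → ℕ
indepCount m a k =
  length (filterᵇ (λ S → isIndependent a S ∧ (∣ S ∣ ≡ᵇ k)) (allSubsets m))

IndPoly : (m : ℕ) → (Fin m → Fin m → Bool) → Poly
IndPoly = indepCount

I : Graph → Poly
I G = IndPoly (n G) (adj G)

cnext : (k : ℕ) → 3 ≤ k → Fin k → Fin k
cnext k k≥3 i = _mod_ (suc (toℕ i)) k {{>-nonZero (≤-trans (s≤s z≤n) k≥3)}}

record Cycle (G : Graph) : Set where
  field
    len      : ℕ
    len≥3    : 3 ≤ len
    vtx      : Fin len → Fin (n G)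
    distinct : Injective _≡_ _≡_ vtx
    edges    : ∀ i → adj G (vtx i) (vtx (cnext len len≥3 i)) ≡ true
open Cycle public

-- (G,C) ∘ 2K₁ : vertices Fin (n + (len + len));
--   inj₁ v = original vertex v, inj₂ (inj₁ i) / inj₂ (inj₂ i) = the two
--   pendant vertices attached to vtx i.

data CorV (m k : ℕ) : Set where
  orig : Fin m → CorV m k
  pend : Fin k → CorV m k

corClass : ∀ {m k} → Fin (m + (k + k)) → CorV m k
corClass {m} {k} x with splitAt m x
... | inj₁ v = orig v
... | inj₂ y with splitAt k y
...   | inj₁ i = pend i
...   | inj₂ i = pend i

corAdj' : (G : Graph) (C : Cycle G) → CorV (n G) (len C) → CorV (n G) (len C) → Bool
corAdj' G C (orig u) (orig v) = adj G u v
corAdj' G C (orig u) (pend i) = ⌊ u ≟ vtx C i ⌋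
corAdj' G C (pend i) (orig v) = ⌊ v ≟ vtx C i ⌋
corAdj' G C (pend i) (pend j) = false

corNum : (G : Graph) → Cycle G → ℕ
corNum G C = n G + (len C + len C)

corAdj : (G : Graph) (C : Cycle G) → Fin (corNum G C) → Fin (corNum G C) → Bool
corAdj G C x y = corAdj' G C (corClass x) (corClass y)

ICorona : (G : Graph) → Cycle G → Poly
ICorona G C = IndPoly (corNum G C) (corAdj G C)

-- (G,C) △ K₁ : vertices Fin (n + len); inj₂ i is the new vertex joined
--   exactly to vtx i and vtx (i+1 mod len).

triClass : ∀ {m k} → Fin (m + k) → CorV m k
triClass {m} x with splitAt m x
... | inj₁ v = orig v
... | inj₂ i = pend i

triAdj' : (G : Graph) (C : Cycle G) → CorV (n G) (len C) → CorV (n G) (len C) → Bool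
triAdj' G C (orig u) (orig v) = adj G u v
triAdj' G C (orig u) (pend i) = ⌊ u ≟ vtx C i ⌋ ∨ ⌊ u ≟ vtx C (cnext (len C) (len≥3 C) i) ⌋
triAdj' G C (pend i) (orig v) = ⌊ v ≟ vtx C i ⌋ ∨ ⌊ v ≟ vtx C (cnext (len C) (len≥3 C) i) ⌋
triAdj' G C (pend i) (pend j) = false

triNum : (G : Graph) → Cycle G → ℕ
triNum G C = n G + len C

triAdj : (G : Graph) (C : Cycle G) → Fin (triNum G C) → Fin (triNum G C) → Bool
triAdj G C x y = triAdj' G C (triClass x) (triClass y)

ITriangle : (G : Graph) → Cycle G → Poly
ITriangle G C = IndPoly (triNum G C) (triAdj G C)

module Submission where

-- A polynomial with natural coefficients is the generating function of a
-- finite multiset of exponents.  We represent such multisets by lists of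
-- naturals, compared by multiplicities (_≈_); the multiset L ⊗ M of all sums
-- a + b realises the product *ₚ, and binom c, the sizes of all subsets of a
-- c-set, realises (1 + x)^c.  The independence polynomial of a graph is the
-- polynomial of the multiset of sizes of its independent sets.
--
-- Both graphs of the theorem extend G by new, pairwise non-adjacent vertices,
-- each attached to some vertices of G (an Extension).  The independent sets of
-- an extension are the S ∪ T with S independent in G and T any set of new
-- vertices without neighbours in S, so the independent sizes of an extension
-- form the union over independent S of |S| + binom(#free new vertices).
-- For S independent, let out be the number of cycle vertices outside S: the
-- corona has 2·out free pendants, the triangle extension one free vertex per
-- cycle edge with both ends outside S; as no edge has both ends in S, summing
-- around the cycle gives 2·out = |C| + #(such edges).  Hence every
-- contribution to the corona is binom |C| ⊗ the one to the triangle extension,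
-- and taking polynomials proves the theorem.

open import Defs hiding (sym)
open import Algebra.Properties.CommutativeSemigroup using (interchange)
open import Data.Nat using (ℕ; zero; suc; _+_; _*_; _∸_; _≡ᵇ_; _≤_; s≤s)
open import Data.Nat.Properties
  using (+-assoc; +-comm; +-identityʳ; *-identityˡ; *-distribʳ-+; *-distribˡ-+; +-commutativeSemigroup; +-0-commutativeMonoid)
open import Data.Nat.DivMod using (_%_; n%n≡0; m<n⇒m%n≡m)
open import Data.Nat.ListAction using (sum)
open import Algebra.Properties.CommutativeMonoid.Sum +-0-commutativeMonoid
  using (∑-distrib-+; sum-cong-≗; sum-init-last) renaming (sum to ∑)
open import Data.Bool using (Bool; true; false; _∧_; _∨_; not; if_then_else_)
open import Data.Bool.Properties using (∨-conicalˡ; ∨-conicalʳ)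
open import Data.Bool.ListAction using (all)
open import Data.List using (List; []; _∷_; _++_; map; concatMap; upTo; filterᵇ; length; tabulate)
open import Data.List.Properties
  using (map-id; map-∘; map-cong; map-applyUpTo; ++-identityʳ; concatMap-++; concatMap-map; concatMap-cong; map-concatMap)
open import Data.Fin using (Fin; zero; suc; toℕ; _↑ˡ_; _↑ʳ_; splitAt; _≟_; inject₁; fromℕ)
open import Data.Fin.Properties
  using (toℕ-injective; toℕ-fromℕ<; toℕ-inject₁; toℕ-fromℕ; toℕ<n; splitAt-↑ˡ; splitAt-↑ʳ; splitAt⁻¹-↑ˡ; splitAt⁻¹-↑ʳ)
open import Data.Fin.Subset using (Subset; ∣_∣)
open import Data.Vec as Vec using (lookup)
open import Data.Vec.Properties using (lookup-++ˡ; lookup-++ʳ)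
open import Data.Product using (_×_; _,_; proj₁; proj₂)
open import Data.Product.Function.NonDependent.Propositional using (_×-⇔_)
open import Data.Sum using (inj₁; inj₂; reduce)
open import Function using (_∘_; _⇔_; mk⇔; Equivalence)
open import Function.Properties.Equivalence using () renaming (trans to ⇔-trans; sym to ⇔-sym)
open import Relation.Nullary.Decidable using (⌊_⌋; yes; no; dec-true; isYes≗does)
open import Relation.Binary.Bundles using (Setoid)
open import Relation.Binary.Structures using (IsEquivalence)
open import Relation.Binary.PropositionalEquality
  using (_≡_; refl; sym; trans; cong; cong₂; subst; module ≡-Reasoning)
import Relation.Binary.Reasoning.Setoid as SetoidReasoning

open Equivalence using (to; from)

-- poly L is the polynomial Σ_{a ∈ L} x^a: its k-th coefficient is the
-- multiplicity of k in L.
poly : List ℕ → Poly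
poly []      k = 0
poly (a ∷ L) k = if a ≡ᵇ k then suc (poly L k) else poly L k

record _≈_ (L M : List ℕ) : Set where
  constructor mk≈
  field coeff : ∀ k → poly L k ≡ poly M k
open _≈_

infix 4 _≈_

≈-isEquivalence : IsEquivalence _≈_
≈-isEquivalence = record
  { refl  = mk≈ λ _ → refl
  ; sym   = λ L≈M → mk≈ λ k → sym (coeff L≈M k)
  ; trans = λ L≈M M≈N → mk≈ λ k → trans (coeff L≈M k) (coeff M≈N k)
  }

≈-setoid : Setoid _ _
≈-setoid = record { isEquivalence = ≈-isEquivalence }

open Setoid ≈-setoid using () renaming (refl to ≈-refl; sym to ≈-sym; trans to ≈-trans; reflexive to ≡⇒≈)

poly-++ : ∀ L M k → poly (L ++ M) k ≡ poly L k + poly M k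
poly-++ []      M k = refl
poly-++ (a ∷ L) M k with a ≡ᵇ k
... | true  = cong suc (poly-++ L M k)
... | false = poly-++ L M k

++-cong : ∀ {L L′ M M′} → L ≈ L′ → M ≈ M′ → L ++ M ≈ L′ ++ M′
++-cong {L} {L′} {M} {M′} L≈L′ M≈M′ = mk≈ λ k → begin
  poly (L ++ M) k        ≡⟨ poly-++ L M k ⟩
  poly L k + poly M k    ≡⟨ cong₂ _+_ (coeff L≈L′ k) (coeff M≈M′ k) ⟩
  poly L′ k + poly M′ k  ≡⟨ poly-++ L′ M′ k ⟨
  poly (L′ ++ M′) k      ∎
  where open ≡-Reasoning

++-comm≈ : ∀ L M → L ++ M ≈ M ++ L
++-comm≈ L M = mk≈ λ k → begin
  poly (L ++ M) k      ≡⟨ poly-++ L M k ⟩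
  poly L k + poly M k  ≡⟨ +-comm (poly L k) (poly M k) ⟩
  poly M k + poly L k  ≡⟨ poly-++ M L k ⟨
  poly (M ++ L) k      ∎
  where open ≡-Reasoning

concatMap-cong≈ : ∀ {A : Set} {f g : A → List ℕ} → (∀ x → f x ≈ g x) → ∀ xs → concatMap f xs ≈ concatMap g xs
concatMap-cong≈ f≈g []       = ≈-refl
concatMap-cong≈ f≈g (x ∷ xs) = ++-cong (f≈g x) (concatMap-cong≈ f≈g xs)

concatMap-[] : ∀ {A : Set} (xs : List A) → concatMap {B = ℕ} (λ _ → []) xs ≡ []
concatMap-[] []       = refl
concatMap-[] (x ∷ xs) = concatMap-[] xs

sum-map-+ : ∀ (f g : ℕ → ℕ) xs → sum (map (λ i → f i + g i) xs) ≡ sum (map f xs) + sum (map g xs)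
sum-map-+ f g []       = refl
sum-map-+ f g (x ∷ xs) = trans (cong (f x + g x +_) (sum-map-+ f g xs))
                               (interchange +-commutativeSemigroup (f x) (g x) _ _)

sum-map-zero : ∀ xs → sum (map (λ (_ : ℕ) → 0) xs) ≡ 0
sum-map-zero []       = refl
sum-map-zero (x ∷ xs) = sum-map-zero xs

sum-upTo-suc : ∀ (f : ℕ → ℕ) k → sum (map f (upTo (suc k))) ≡ f 0 + sum (map (f ∘ suc) (upTo k))
sum-upTo-suc f k = cong (λ xs → f 0 + sum xs)
  (trans (map-applyUpTo suc f k) (sym (map-applyUpTo (λ i → i) (f ∘ suc) k)))

*ₚ-cong : ∀ {p p′ q q′ : Poly} → (∀ i → p i ≡ p′ i) → (∀ i → q i ≡ q′ i) → ∀ k → (p *ₚ q) k ≡ (p′ *ₚ q′) k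
*ₚ-cong p≗p′ q≗q′ k = cong sum (map-cong (λ i → cong₂ _*_ (p≗p′ i) (q≗q′ (k ∸ i))) (upTo (suc k)))

*ₚ-distribʳ : ∀ (p q r : Poly) k → ((λ i → p i + q i) *ₚ r) k ≡ (p *ₚ r) k + (q *ₚ r) k
*ₚ-distribʳ p q r k =
  trans (cong sum (map-cong (λ i → *-distribʳ-+ (r (k ∸ i)) (p i) (q i)) (upTo (suc k))))
        (sum-map-+ (λ i → p i * r (k ∸ i)) (λ i → q i * r (k ∸ i)) (upTo (suc k)))

*ₚ-distribˡ : ∀ (p q r : Poly) k → (p *ₚ (λ i → q i + r i)) k ≡ (p *ₚ q) k + (p *ₚ r) k
*ₚ-distribˡ p q r k =
  trans (cong sum (map-cong (λ i → *-distribˡ-+ (p i) (q (k ∸ i)) (r (k ∸ i))) (upTo (suc k))))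
        (sum-map-+ (λ i → p i * q (k ∸ i)) (λ i → p i * r (k ∸ i)) (upTo (suc k)))

poly-map-suc-zero : ∀ L → poly (map suc L) 0 ≡ 0
poly-map-suc-zero []      = refl
poly-map-suc-zero (a ∷ L) = poly-map-suc-zero L

poly-map-suc : ∀ L k → poly (map suc L) (suc k) ≡ poly L k
poly-map-suc []      k = refl
poly-map-suc (a ∷ L) k with a ≡ᵇ k
... | true  = cong suc (poly-map-suc L k)
... | false = poly-map-suc L k

poly-shift : ∀ s M k → poly (map (s +_) M) k ≡ (poly (s ∷ []) *ₚ poly M) k
poly-shift zero M k = begin
  poly (map (0 +_) M) k                           ≡⟨ cong (λ L → poly L k) (map-id M) ⟩
  poly M k                                        ≡⟨ *-identityˡ (poly M k) ⟨
  1 * poly M k                                    ≡⟨ +-identityʳ _ ⟨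
  1 * poly M k + 0                                ≡⟨ cong (1 * poly M k +_) (sum-map-zero (upTo k)) ⟨
  1 * poly M k + sum (map (λ _ → 0) (upTo k))     ≡⟨ sum-upTo-suc (λ i → poly (0 ∷ []) i * poly M (k ∸ i)) k ⟨
  (poly (0 ∷ []) *ₚ poly M) k                     ∎
  where open ≡-Reasoning
poly-shift (suc s) M zero = begin
  poly (map (suc s +_) M) 0         ≡⟨ cong (λ L → poly L 0) (map-∘ {g = suc} {f = s +_} M) ⟩
  poly (map suc (map (s +_) M)) 0   ≡⟨ poly-map-suc-zero (map (s +_) M) ⟩
  0                                 ∎
  where open ≡-Reasoning
poly-shift (suc s) M (suc k) = begin
  poly (map (suc s +_) M) (suc k)         ≡⟨ cong (λ L → poly L (suc k)) (map-∘ {g = suc} {f = s +_} M) ⟩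
  poly (map suc (map (s +_) M)) (suc k)   ≡⟨ poly-map-suc (map (s +_) M) k ⟩
  poly (map (s +_) M) k                   ≡⟨ poly-shift s M k ⟩
  (poly (s ∷ []) *ₚ poly M) k             ≡⟨ sum-upTo-suc (λ i → poly (suc s ∷ []) i * poly M (suc k ∸ i)) (suc k) ⟨
  (poly (suc s ∷ []) *ₚ poly M) (suc k)   ∎
  where open ≡-Reasoning

shift-cong : ∀ s {L M} → L ≈ M → map (s +_) L ≈ map (s +_) M
shift-cong s {L} {M} L≈M = mk≈ λ k →
  trans (poly-shift s L k) (trans (*ₚ-cong {p = poly (s ∷ [])} {p′ = poly (s ∷ [])} (λ _ → refl) (coeff L≈M) k) (sym (poly-shift s M k)))

_⊗_ : List ℕ → List ℕ → List ℕ
L ⊗ M = concatMap (λ a → map (a +_) M) L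

infixl 7 _⊗_

-- Distributing over the first factor reduces this to poly-shift.
poly-⊗ : ∀ L M k → poly (L ⊗ M) k ≡ (poly L *ₚ poly M) k
poly-⊗ []      M k = sym (sum-map-zero (upTo (suc k)))
poly-⊗ (a ∷ L) M k = begin
  poly (map (a +_) M ++ L ⊗ M) k                          ≡⟨ poly-++ (map (a +_) M) (L ⊗ M) k ⟩
  poly (map (a +_) M) k + poly (L ⊗ M) k                  ≡⟨ cong₂ _+_ (poly-shift a M k) (poly-⊗ L M k) ⟩
  (poly (a ∷ []) *ₚ poly M) k + (poly L *ₚ poly M) k      ≡⟨ *ₚ-distribʳ (poly (a ∷ [])) (poly L) (poly M) k ⟨
  ((λ i → poly (a ∷ []) i + poly L i) *ₚ poly M) k        ≡⟨ *ₚ-cong {q = poly M} {q′ = poly M} (λ i → poly-++ (a ∷ []) L i) (λ _ → refl) k ⟨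
  (poly (a ∷ L) *ₚ poly M) k                              ∎
  where open ≡-Reasoning

⊗-cong : ∀ {L L′ M M′} → L ≈ L′ → M ≈ M′ → L ⊗ M ≈ L′ ⊗ M′
⊗-cong {L} {L′} {M} {M′} L≈L′ M≈M′ = mk≈ λ k →
  trans (poly-⊗ L M k) (trans (*ₚ-cong (coeff L≈L′) (coeff M≈M′) k) (sym (poly-⊗ L′ M′ k)))

⊗-[] : ∀ L → L ⊗ [] ≡ []
⊗-[] []      = refl
⊗-[] (a ∷ L) = ⊗-[] L

⊗-++ʳ : ∀ L M N → L ⊗ (M ++ N) ≈ L ⊗ M ++ L ⊗ N
⊗-++ʳ L M N = mk≈ λ k → begin
  poly (L ⊗ (M ++ N)) k                                 ≡⟨ poly-⊗ L (M ++ N) k ⟩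
  (poly L *ₚ poly (M ++ N)) k                           ≡⟨ *ₚ-cong {p = poly L} {p′ = poly L} (λ _ → refl) (poly-++ M N) k ⟩
  (poly L *ₚ (λ i → poly M i + poly N i)) k             ≡⟨ *ₚ-distribˡ (poly L) (poly M) (poly N) k ⟩
  (poly L *ₚ poly M) k + (poly L *ₚ poly N) k           ≡⟨ cong₂ _+_ (poly-⊗ L M k) (poly-⊗ L N k) ⟨
  poly (L ⊗ M) k + poly (L ⊗ N) k                       ≡⟨ poly-++ (L ⊗ M) (L ⊗ N) k ⟨
  poly (L ⊗ M ++ L ⊗ N) k                               ∎
  where open ≡-Reasoning

⊗-concatMap : ∀ {A : Set} L (h : A → List ℕ) xs → L ⊗ concatMap h xs ≈ concatMap (λ x → L ⊗ h x) xs
⊗-concatMap L h []       = ≡⇒≈ (⊗-[] L)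
⊗-concatMap L h (x ∷ xs) =
  ≈-trans (⊗-++ʳ L (h x) (concatMap h xs)) (++-cong ≈-refl (⊗-concatMap L h xs))

⊗-shiftˡ : ∀ s L M → map (s +_) L ⊗ M ≡ map (s +_) (L ⊗ M)
⊗-shiftˡ s L M = begin
  concatMap (λ a → map (a +_) M) (map (s +_) L)    ≡⟨ concatMap-map _ (s +_) L ⟩
  concatMap (λ a → map (s + a +_) M) L             ≡⟨ concatMap-cong (λ a → shift-shift a) L ⟩
  concatMap (λ a → map (s +_) (map (a +_) M)) L    ≡⟨ map-concatMap (s +_) _ L ⟨
  map (s +_) (L ⊗ M)                               ∎
  where
  open ≡-Reasoning
  shift-shift : ∀ a → map (s + a +_) M ≡ map (s +_) (map (a +_) M)
  shift-shift a = trans (map-cong (+-assoc s a) M) (map-∘ {g = s +_} {f = a +_} M)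

⊗-shiftʳ : ∀ s L M → L ⊗ map (s +_) M ≡ map (s +_) (L ⊗ M)
⊗-shiftʳ s L M = begin
  concatMap (λ a → map (a +_) (map (s +_) M)) L    ≡⟨ concatMap-cong (λ a → shift-swap a) L ⟩
  concatMap (λ a → map (s +_) (map (a +_) M)) L    ≡⟨ map-concatMap (s +_) _ L ⟨
  map (s +_) (L ⊗ M)                               ∎
  where
  open ≡-Reasoning
  swap : ∀ a x → a + (s + x) ≡ s + (a + x)
  swap a x = trans (sym (+-assoc a s x)) (trans (cong (_+ x) (+-comm a s)) (+-assoc s a x))
  shift-swap : ∀ a → map (a +_) (map (s +_) M) ≡ map (s +_) (map (a +_) M)
  shift-swap a = trans (sym (map-∘ M)) (trans (map-cong (swap a) M) (map-∘ M))

-- binom c is the multiset of sizes of the subsets of a c-element set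
-- (a subset of c + 1 elements either omits or contains the last one);
-- its polynomial is (1 + x)^c.
binom : ℕ → List ℕ
binom zero    = 0 ∷ []
binom (suc c) = binom c ++ map suc (binom c)

poly-onePlusX : ∀ k → onePlusX k ≡ poly (0 ∷ 1 ∷ []) k
poly-onePlusX zero          = refl
poly-onePlusX (suc zero)    = refl
poly-onePlusX (suc (suc k)) = refl

poly-binom : ∀ c k → poly (binom c) k ≡ (onePlusX ^ₚ c) k
poly-binom zero    zero    = refl
poly-binom zero    (suc k) = refl
poly-binom (suc c) k = begin
  poly (binom c ++ map suc (binom c)) k                ≡⟨ cong (λ L → poly L k) multiply-by-1+x ⟨
  poly ((0 ∷ 1 ∷ []) ⊗ binom c) k                      ≡⟨ poly-⊗ (0 ∷ 1 ∷ []) (binom c) k ⟩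
  (poly (0 ∷ 1 ∷ []) *ₚ poly (binom c)) k              ≡⟨ *ₚ-cong (λ i → sym (poly-onePlusX i)) (poly-binom c) k ⟩
  (onePlusX *ₚ (onePlusX ^ₚ c)) k                      ∎
  where
  open ≡-Reasoning
  multiply-by-1+x : (0 ∷ 1 ∷ []) ⊗ binom c ≡ binom c ++ map suc (binom c)
  multiply-by-1+x = cong₂ _++_ (map-id (binom c)) (++-identityʳ (map suc (binom c)))

binom-+ : ∀ c e → binom c ⊗ binom e ≈ binom (c + e)
binom-+ zero    e = ≡⇒≈ (trans (++-identityʳ _) (map-id (binom e)))
binom-+ (suc c) e = begin
  (binom c ++ map suc (binom c)) ⊗ binom e           ≡⟨ concatMap-++ _ (binom c) (map suc (binom c)) ⟩
  binom c ⊗ binom e ++ map suc (binom c) ⊗ binom e   ≡⟨ cong (binom c ⊗ binom e ++_) (⊗-shiftˡ 1 (binom c) (binom e)) ⟩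
  binom c ⊗ binom e ++ map suc (binom c ⊗ binom e)   ≈⟨ ++-cong (binom-+ c e) (shift-cong 1 (binom-+ c e)) ⟩
  binom (c + e) ++ map suc (binom (c + e))           ∎
  where open SetoidReasoning ≈-setoid

bool-ext : ∀ {a b : Bool} → (a ≡ true ⇔ b ≡ true) → a ≡ b
bool-ext {true}  a⇔b = sym (to a⇔b refl)
bool-ext {false} {true}  a⇔b = from a⇔b refl
bool-ext {false} {false} a⇔b = refl

∧-⇔ : ∀ {a b} → (a ∧ b ≡ true) ⇔ (a ≡ true × b ≡ true)
∧-⇔ {true}  {b} = mk⇔ (refl ,_) proj₂
∧-⇔ {false} {b} = mk⇔ (λ ()) (λ ())

all-tabulate : ∀ {A : Set} {k} (g : Fin k → A) (f : A → Bool) →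
               all f (tabulate g) ≡ true ⇔ (∀ i → f (g i) ≡ true)
all-tabulate {k = zero}  g f = mk⇔ (λ _ ()) (λ _ → refl)
all-tabulate {k = suc k} g f = mk⇔
  (λ holds → λ { zero → proj₁ (to ∧-⇔ holds) ; (suc i) → to (all-tabulate (g ∘ suc) f) (proj₂ (to ∧-⇔ holds)) i })
  (λ holds → from ∧-⇔ (holds zero , from (all-tabulate (g ∘ suc) f) (holds ∘ suc)))

Avoids : ∀ {m} → Subset m → (Fin m → Bool) → Set
Avoids S N = ∀ v → lookup S v ≡ true → N v ≡ false

Independent : ∀ {m} → (Fin m → Fin m → Bool) → Subset m → Set
Independent a S = ∀ u → lookup S u ≡ true → Avoids S (a u)

isIndependent-⇔ : ∀ {m} (a : Fin m → Fin m → Bool) S → isIndependent a S ≡ true ⇔ Independent a S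
isIndependent-⇔ a S = mk⇔
  (λ test u su v sv → to (pair-⇔ (lookup S u) (lookup S v) (a u v))
     (to (all-tabulate (λ v → v) _) (to (all-tabulate (λ u → u) _) test u) v) su sv)
  (λ indep → from (all-tabulate (λ u → u) _) λ u → from (all-tabulate (λ v → v) _) λ v →
     from (pair-⇔ (lookup S u) (lookup S v) (a u v)) (λ su sv → indep u su v sv))
  where
  pair-⇔ : ∀ x y z → not (x ∧ y ∧ z) ≡ true ⇔ (x ≡ true → y ≡ true → z ≡ false)
  pair-⇔ true  true  true  = mk⇔ (λ ()) (λ h → sym (h refl refl))
  pair-⇔ true  true  false = mk⇔ (λ _ _ _ → refl) (λ _ → refl)
  pair-⇔ true  false z     = mk⇔ (λ _ _ ()) (λ _ → refl)
  pair-⇔ false y     z     = mk⇔ (λ _ ()) (λ _ → refl)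

indepSizes : ∀ {m} → (Fin m → Fin m → Bool) → List ℕ
indepSizes {m} a = concatMap (λ S → if isIndependent a S then ∣ S ∣ ∷ [] else []) (allSubsets m)

IndPoly-indepSizes : ∀ m (a : Fin m → Fin m → Bool) k → IndPoly m a k ≡ poly (indepSizes a) k
IndPoly-indepSizes m a k = counts (allSubsets m)
  where
  counts : ∀ Ss → length (filterᵇ (λ S → isIndependent a S ∧ (∣ S ∣ ≡ᵇ k)) Ss)
                  ≡ poly (concatMap (λ S → if isIndependent a S then ∣ S ∣ ∷ [] else []) Ss) k
  counts []       = refl
  counts (S ∷ Ss) with isIndependent a S
  ... | false = counts Ss
  ... | true with ∣ S ∣ ≡ᵇ k
  ...   | true  = cong suc (counts Ss)
  ...   | false = counts Ss

-- Every subset of Fin (m + p) is uniquely of the form S ++ T.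
concatMap-allSubsets-++ : ∀ {A : Set} m p (g : Subset (m + p) → List A) →
  concatMap g (allSubsets (m + p))
    ≡ concatMap (λ S → concatMap (λ T → g (S Vec.++ T)) (allSubsets p)) (allSubsets m)
concatMap-allSubsets-++ zero    p g = sym (++-identityʳ _)
concatMap-allSubsets-++ (suc m) p g = begin
  concatMap g (map (true Vec.∷_) Us ++ map (false Vec.∷_) Us)
    ≡⟨ concatMap-++ g (map (true Vec.∷_) Us) (map (false Vec.∷_) Us) ⟩
  concatMap g (map (true Vec.∷_) Us) ++ concatMap g (map (false Vec.∷_) Us)
    ≡⟨ cong₂ _++_ (split true) (split false) ⟩
  concatMap h (map (true Vec.∷_) Ss) ++ concatMap h (map (false Vec.∷_) Ss)
    ≡⟨ concatMap-++ h (map (true Vec.∷_) Ss) (map (false Vec.∷_) Ss) ⟨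
  concatMap h (map (true Vec.∷_) Ss ++ map (false Vec.∷_) Ss)
    ∎
  where
  open ≡-Reasoning
  Us = allSubsets (m + p)
  Ss = allSubsets m
  h : Subset (suc m) → List _
  h S = concatMap (λ T → g (S Vec.++ T)) (allSubsets p)
  split : ∀ b → concatMap g (map (b Vec.∷_) Us) ≡ concatMap h (map (b Vec.∷_) Ss)
  split b = trans (concatMap-map g (b Vec.∷_) Us)
           (trans (concatMap-allSubsets-++ m p (g ∘ (b Vec.∷_)))
                  (sym (concatMap-map h (b Vec.∷_) Ss)))

size-++ : ∀ {m p} (S : Subset m) (T : Subset p) → ∣ S Vec.++ T ∣ ≡ ∣ S ∣ + ∣ T ∣
size-++ Vec.[]           T = refl
size-++ (true Vec.∷ S)  T = cong suc (size-++ S T)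
size-++ (false Vec.∷ S) T = size-++ S T

within : ∀ {p} → (Fin p → Bool) → Subset p → Bool
within F Vec.[]           = true
within F (true Vec.∷ T)  = F zero ∧ within (F ∘ suc) T
within F (false Vec.∷ T) = within (F ∘ suc) T

within-⇔ : ∀ {p} (F : Fin p → Bool) T → within F T ≡ true ⇔ (∀ j → lookup T j ≡ true → F j ≡ true)
within-⇔ F Vec.[] = mk⇔ (λ _ ()) (λ _ → refl)
within-⇔ F (true Vec.∷ T) = mk⇔
  (λ holds → λ { zero _ → proj₁ (to ∧-⇔ holds) ; (suc j) → to (within-⇔ (F ∘ suc) T) (proj₂ (to ∧-⇔ holds)) j })
  (λ inF → from ∧-⇔ (inF zero refl , from (within-⇔ (F ∘ suc) T) (inF ∘ suc)))
within-⇔ F (false Vec.∷ T) = mk⇔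
  (λ holds → λ { zero () ; (suc j) → to (within-⇔ (F ∘ suc) T) holds j })
  (λ inF → from (within-⇔ (F ∘ suc) T) (inF ∘ suc))

bit : Bool → ℕ
bit true  = 1
bit false = 0

count : ∀ {p} → (Fin p → Bool) → ℕ
count F = ∑ (bit ∘ F)

withinSizes : ∀ {p} → (Fin p → Bool) → List ℕ
withinSizes {p} F = concatMap (λ T → if within F T then ∣ T ∣ ∷ [] else []) (allSubsets p)

withinSizes-shift : ∀ {p} c s (F : Fin p → Bool) →
  concatMap (λ T → if c ∧ within F T then s + ∣ T ∣ ∷ [] else []) (allSubsets p)
    ≡ (if c then map (s +_) (withinSizes F) else [])
withinSizes-shift {p} false s F = concatMap-[] (allSubsets p)
withinSizes-shift {p} true  s F =
  trans (concatMap-cong (λ T → map-singleton (within F T) ∣ T ∣) (allSubsets p))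
        (sym (map-concatMap (s +_) _ (allSubsets p)))
  where
  map-singleton : ∀ b x → (if b then s + x ∷ [] else []) ≡ map (s +_) (if b then x ∷ [] else [])
  map-singleton true  x = refl
  map-singleton false x = refl

withinSizes-step : ∀ {p} (F : Fin (suc p) → Bool) →
  withinSizes F ≡ (if F zero then map suc (withinSizes (F ∘ suc)) else []) ++ withinSizes (F ∘ suc)
withinSizes-step {p} F = begin
  concatMap g (map (true Vec.∷_) Ts ++ map (false Vec.∷_) Ts)
    ≡⟨ concatMap-++ g (map (true Vec.∷_) Ts) (map (false Vec.∷_) Ts) ⟩
  concatMap g (map (true Vec.∷_) Ts) ++ concatMap g (map (false Vec.∷_) Ts)
    ≡⟨ cong₂ _++_ (concatMap-map g (true Vec.∷_) Ts) (concatMap-map g (false Vec.∷_) Ts) ⟩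
  concatMap (g ∘ (true Vec.∷_)) Ts ++ withinSizes (F ∘ suc)
    ≡⟨ cong (_++ withinSizes (F ∘ suc)) (withinSizes-shift (F zero) 1 (F ∘ suc)) ⟩
  (if F zero then map suc (withinSizes (F ∘ suc)) else []) ++ withinSizes (F ∘ suc)
    ∎
  where
  open ≡-Reasoning
  Ts = allSubsets p
  g : Subset (suc p) → List ℕ
  g T = if within F T then ∣ T ∣ ∷ [] else []

withinSizes-binom : ∀ {p} (F : Fin p → Bool) → withinSizes F ≈ binom (count F)
withinSizes-binom {zero}  F = ≈-refl
withinSizes-binom {suc p} F = ≈-trans (≡⇒≈ (withinSizes-step F)) (by-first-element (F zero))
  where
  W = withinSizes (F ∘ suc)
  W≈ = withinSizes-binom (F ∘ suc)
  by-first-element : ∀ b → (if b then map suc W else []) ++ W ≈ binom (bit b + count (F ∘ suc))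
  by-first-element true  = ≈-trans (++-comm≈ (map suc W) W) (++-cong W≈ (shift-cong 1 W≈))
  by-first-element false = W≈

fin-cases : ∀ {m p} (P : Fin (m + p) → Set) → (∀ u → P (u ↑ˡ p)) → (∀ j → P (m ↑ʳ j)) → ∀ x → P x
fin-cases {m} {p} P old new x with splitAt m x in eq
... | inj₁ u = subst P (splitAt⁻¹-↑ˡ eq) (old u)
... | inj₂ j = subst P (splitAt⁻¹-↑ʳ eq) (new j)

record Extension {m p} (a : Fin m → Fin m → Bool) (att : Fin p → Fin m → Bool)
                 (b : Fin (m + p) → Fin (m + p) → Bool) : Set where
  field
    old-old : ∀ u v → b (u ↑ˡ p) (v ↑ˡ p) ≡ a u v
    old-new : ∀ u j → b (u ↑ˡ p) (m ↑ʳ j) ≡ att j u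
    new-old : ∀ j v → b (m ↑ʳ j) (v ↑ˡ p) ≡ att j v
    new-new : ∀ i j → b (m ↑ʳ i) (m ↑ʳ j) ≡ false

module _ {m p} {a : Fin m → Fin m → Bool} {att : Fin p → Fin m → Bool}
         {b : Fin (m + p) → Fin (m + p) → Bool} (ext : Extension a att b) where
  open Extension ext

  extension-Independent : ∀ S T →
    Independent b (S Vec.++ T) ⇔ (Independent a S × (∀ j → lookup T j ≡ true → Avoids S (att j)))
  extension-Independent S T = mk⇔
    (λ indep → (λ u su v sv → trans (sym (old-old u v)) (indep (u ↑ˡ p) (inS su) (v ↑ˡ p) (inS sv)))
             , (λ j tj v sv → trans (sym (new-old j v)) (indep (m ↑ʳ j) (inT tj) (v ↑ˡ p) (inS sv))))
    (λ { (indepS , free) → fin-cases _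
      (λ u su → fin-cases _
        (λ v sv → trans (old-old u v) (indepS u (outS su) v (outS sv)))
        (λ j tj → trans (old-new u j) (free j (outT tj) u (outS su))))
      (λ j tj → fin-cases _
        (λ v sv → trans (new-old j v) (free j (outT tj) v (outS sv)))
        (λ i _ → new-new j i)) })
    where
    inS : ∀ {u} → lookup S u ≡ true → lookup (S Vec.++ T) (u ↑ˡ p) ≡ true
    inS {u} = trans (lookup-++ˡ S T u)
    inT : ∀ {j} → lookup T j ≡ true → lookup (S Vec.++ T) (m ↑ʳ j) ≡ true
    inT {j} = trans (lookup-++ʳ S T j)
    outS : ∀ {u} → lookup (S Vec.++ T) (u ↑ˡ p) ≡ true → lookup S u ≡ true
    outS {u} = trans (sym (lookup-++ˡ S T u))
    outT : ∀ {j} → lookup (S Vec.++ T) (m ↑ʳ j) ≡ true → lookup T j ≡ true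
    outT {j} = trans (sym (lookup-++ʳ S T j))

  extension-isIndependent : ∀ S (F : Fin p → Bool) → (∀ j → F j ≡ true ⇔ Avoids S (att j)) → ∀ T →
    isIndependent b (S Vec.++ T) ≡ isIndependent a S ∧ within F T
  extension-isIndependent S F F⇔ T = bool-ext
    (⇔-trans (isIndependent-⇔ b (S Vec.++ T))
    (⇔-trans (extension-Independent S T)
    (⇔-trans (⇔-sym (isIndependent-⇔ a S) ×-⇔ free⇔)
             (⇔-sym ∧-⇔))))
    where
    free⇔ : (∀ j → lookup T j ≡ true → Avoids S (att j)) ⇔ within F T ≡ true
    free⇔ = ⇔-trans (mk⇔ (λ free j tj → from (F⇔ j) (free j tj)) (λ inF j tj → to (F⇔ j) (inF j tj)))
                    (⇔-sym (within-⇔ F T))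

if-cong≈ : ∀ c {L M} → L ≈ M → (if c then L else []) ≈ (if c then M else [])
if-cong≈ true  L≈M = L≈M
if-cong≈ false L≈M = ≈-refl

-- The size multiset of an extension in which every independent set S of the
-- old graph leaves exactly free S new vertices available.
extSizes : ∀ {m} → (Fin m → Fin m → Bool) → (Subset m → ℕ) → List ℕ
extSizes {m} a free =
  concatMap (λ S → if isIndependent a S then map (∣ S ∣ +_) (binom (free S)) else []) (allSubsets m)

-- Independent sets of an extension are the S ∪ T of extension-isIndependent;
-- for fixed independent S the admissible T are the subsets of F S, whose
-- sizes form binom (count (F S)).
indepSizes-extension : ∀ {m p} {a : Fin m → Fin m → Bool} {att : Fin p → Fin m → Bool}
  {b : Fin (m + p) → Fin (m + p) → Bool} → Extension a att b →
  (F : Subset m → Fin p → Bool) → (∀ S j → F S j ≡ true ⇔ Avoids S (att j)) →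
  indepSizes b ≈ extSizes a (count ∘ F)
indepSizes-extension {m} {p} {a} {b = b} ext F F⇔ = begin
  concatMap sizeIfIndependent (allSubsets (m + p))
    ≡⟨ concatMap-allSubsets-++ m p sizeIfIndependent ⟩
  concatMap (λ S → concatMap (λ T → sizeIfIndependent (S Vec.++ T)) (allSubsets p)) (allSubsets m)
    ≡⟨ concatMap-cong split (allSubsets m) ⟩
  concatMap (λ S → if isIndependent a S then map (∣ S ∣ +_) (withinSizes (F S)) else []) (allSubsets m)
    ≈⟨ concatMap-cong≈ (λ S → if-cong≈ (isIndependent a S) (shift-cong ∣ S ∣ (withinSizes-binom (F S))))
                       (allSubsets m) ⟩
  extSizes a (count ∘ F)
    ∎
  where
  open SetoidReasoning ≈-setoid
  sizeIfIndependent : Subset (m + p) → List ℕ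
  sizeIfIndependent U = if isIndependent b U then ∣ U ∣ ∷ [] else []
  split : ∀ S → concatMap (λ T → sizeIfIndependent (S Vec.++ T)) (allSubsets p)
              ≡ (if isIndependent a S then map (∣ S ∣ +_) (withinSizes (F S)) else [])
  split S = trans
    (concatMap-cong (λ T → cong₂ (λ c n → if c then n ∷ [] else [])
                                 (extension-isIndependent ext S (F S) (F⇔ S) T) (size-++ S T))
                    (allSubsets p))
    (withinSizes-shift (isIndependent a S) ∣ S ∣ (F S))

extSizes-factor : ∀ {m} (a : Fin m → Fin m → Bool) (f g : Subset m → ℕ) c →
  (∀ S → Independent a S → f S ≡ c + g S) → extSizes a f ≈ binom c ⊗ extSizes a g
extSizes-factor {m} a f g c f≡c+g = ≈-trans (concatMap-cong≈ per-set (allSubsets m))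
  (≈-sym (⊗-concatMap (binom c) _ (allSubsets m)))
  where
  per-set : ∀ S → (if isIndependent a S then map (∣ S ∣ +_) (binom (f S)) else [])
                  ≈ binom c ⊗ (if isIndependent a S then map (∣ S ∣ +_) (binom (g S)) else [])
  per-set S with isIndependent a S in indep
  ... | false = ≡⇒≈ (sym (⊗-[] (binom c)))
  ... | true  = begin
    map (∣ S ∣ +_) (binom (f S))                 ≡⟨ cong (map (∣ S ∣ +_) ∘ binom) (f≡c+g S (to (isIndependent-⇔ a S) indep)) ⟩
    map (∣ S ∣ +_) (binom (c + g S))             ≈⟨ shift-cong ∣ S ∣ (binom-+ c (g S)) ⟨
    map (∣ S ∣ +_) (binom c ⊗ binom (g S))       ≡⟨ ⊗-shiftʳ ∣ S ∣ (binom c) (binom (g S)) ⟨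
    binom c ⊗ map (∣ S ∣ +_) (binom (g S))       ∎
    where open SetoidReasoning ≈-setoid

∑-++ : ∀ m p (h : Fin (m + p) → ℕ) → ∑ h ≡ ∑ (h ∘ (_↑ˡ p)) + ∑ (h ∘ (m ↑ʳ_))
∑-++ zero    p h = refl
∑-++ (suc m) p h = trans (cong (h zero +_) (∑-++ m p (h ∘ suc))) (sym (+-assoc (h zero) _ _))

∑-ones : ∀ n → ∑ {n} (λ _ → 1) ≡ n
∑-ones zero    = refl
∑-ones (suc n) = cong suc (∑-ones n)

cnext-inject₁ : ∀ k (k≥3 : 3 ≤ suc k) i → cnext (suc k) k≥3 (inject₁ i) ≡ suc i
cnext-inject₁ k k≥3 i = toℕ-injective (begin
  toℕ (cnext (suc k) k≥3 (inject₁ i))   ≡⟨ toℕ-fromℕ< _ ⟩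
  suc (toℕ (inject₁ i)) % suc k         ≡⟨ cong (λ t → suc t % suc k) (toℕ-inject₁ i) ⟩
  suc (toℕ i) % suc k                   ≡⟨ m<n⇒m%n≡m (s≤s (toℕ<n i)) ⟩
  suc (toℕ i)                           ∎)
  where open ≡-Reasoning

cnext-last : ∀ k (k≥3 : 3 ≤ suc k) → cnext (suc k) k≥3 (fromℕ k) ≡ zero
cnext-last k k≥3 = toℕ-injective (begin
  toℕ (cnext (suc k) k≥3 (fromℕ k))   ≡⟨ toℕ-fromℕ< _ ⟩
  suc (toℕ (fromℕ k)) % suc k         ≡⟨ cong (λ t → suc t % suc k) (toℕ-fromℕ k) ⟩
  suc k % suc k                       ≡⟨ n%n≡0 (suc k) ⟩
  0                                   ∎)
  where open ≡-Reasoning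

∑-rotate : ∀ k (k≥3 : 3 ≤ k) (h : Fin k → ℕ) → ∑ (h ∘ cnext k k≥3) ≡ ∑ h
∑-rotate (suc k) k≥3 h = begin
  ∑ (h ∘ cnext (suc k) k≥3)
    ≡⟨ sum-init-last (h ∘ cnext (suc k) k≥3) ⟩
  ∑ (h ∘ cnext (suc k) k≥3 ∘ inject₁) + h (cnext (suc k) k≥3 (fromℕ k))
    ≡⟨ cong₂ _+_ (sum-cong-≗ (cong h ∘ cnext-inject₁ k k≥3)) (cong h (cnext-last k k≥3)) ⟩
  ∑ (h ∘ suc) + h zero
    ≡⟨ +-comm (∑ (h ∘ suc)) (h zero) ⟩
  ∑ h
    ∎
  where open ≡-Reasoning

bit-not-pair : ∀ x y → x ∧ y ≡ false → bit (not x) + bit (not y) ≡ 1 + bit (not x ∧ not y)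
bit-not-pair true  true  ()
bit-not-pair true  false _ = refl
bit-not-pair false true  _ = refl
bit-not-pair false false _ = refl

avoids-vertex : ∀ {m} (S : Subset m) (w : Fin m) → not (lookup S w) ≡ true ⇔ Avoids S (λ u → ⌊ u ≟ w ⌋)
avoids-vertex S w = mk⇔ to′ from′
  where
  to′ : not (lookup S w) ≡ true → Avoids S (λ u → ⌊ u ≟ w ⌋)
  to′ w∉S v v∈S with v ≟ w
  ... | no  _    = refl
  ... | yes refl with lookup S v
  ...   | false = sym v∈S
  ...   | true  = sym w∉S
  from′ : Avoids S (λ u → ⌊ u ≟ w ⌋) → not (lookup S w) ≡ true
  from′ avoids with lookup S w in w∈S
  ... | false = refl
  ... | true  = trans (sym (avoids w w∈S)) w~w
    where
    w~w : ⌊ w ≟ w ⌋ ≡ true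
    w~w = trans (isYes≗does (w ≟ w)) (dec-true (w ≟ w) refl)

avoids-∨ : ∀ {m} (S : Subset m) (N N′ : Fin m → Bool) →
           Avoids S (λ u → N u ∨ N′ u) ⇔ (Avoids S N × Avoids S N′)
avoids-∨ S N N′ = mk⇔
  (λ avoids → (λ v v∈S → ∨-conicalˡ (N v) (N′ v) (avoids v v∈S))
            , (λ v v∈S → ∨-conicalʳ (N v) (N′ v) (avoids v v∈S)))
  (λ { (avoidsN , avoidsN′) v v∈S → cong₂ _∨_ (avoidsN v v∈S) (avoidsN′ v v∈S) })

-- The corona has two pendants per cycle vertex: both i ↑ˡ k and k ↑ʳ i hang
-- at cycle vertex i.
pendantOf : ∀ {k} → Fin (k + k) → Fin k
pendantOf {k} j = reduce (splitAt k j)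

pendantOf-↑ˡ : ∀ {k} (i : Fin k) → pendantOf (i ↑ˡ k) ≡ i
pendantOf-↑ˡ {k} i = cong reduce (splitAt-↑ˡ k i k)

pendantOf-↑ʳ : ∀ {k} (i : Fin k) → pendantOf (k ↑ʳ i) ≡ i
pendantOf-↑ʳ {k} i = cong reduce (splitAt-↑ʳ k k i)

corClass-old : ∀ {m k} (u : Fin m) → corClass {m} {k} (u ↑ˡ (k + k)) ≡ orig u
corClass-old {m} {k} u rewrite splitAt-↑ˡ m u (k + k) = refl

corClass-new : ∀ {m k} (j : Fin (k + k)) → corClass {m} {k} (m ↑ʳ j) ≡ pend (pendantOf j)
corClass-new {m} {k} j rewrite splitAt-↑ʳ m (k + k) j with splitAt k j
... | inj₁ i = refl
... | inj₂ i = refl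

triClass-old : ∀ {m k} (u : Fin m) → triClass {m} {k} (u ↑ˡ k) ≡ orig u
triClass-old {m} {k} u rewrite splitAt-↑ˡ m u k = refl

triClass-new : ∀ {m k} (i : Fin k) → triClass {m} {k} (m ↑ʳ i) ≡ pend i
triClass-new {m} {k} i rewrite splitAt-↑ʳ m k i = refl

module _ (G : Graph) (C : Cycle G) where
  private
    c = len C
    next = cnext (len C) (len≥3 C)

  coronaAtt : Fin (c + c) → Fin (n G) → Bool
  coronaAtt j u = ⌊ u ≟ vtx C (pendantOf j) ⌋

  triangleAtt : Fin c → Fin (n G) → Bool
  triangleAtt i u = ⌊ u ≟ vtx C i ⌋ ∨ ⌊ u ≟ vtx C (next i) ⌋

  corona-Extension : Extension (adj G) coronaAtt (corAdj G C)
  corona-Extension = record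
    { old-old = λ u v → cong₂ (corAdj' G C) (corClass-old u) (corClass-old v)
    ; old-new = λ u j → cong₂ (corAdj' G C) (corClass-old u) (corClass-new j)
    ; new-old = λ j v → cong₂ (corAdj' G C) (corClass-new j) (corClass-old v)
    ; new-new = λ i j → cong₂ (corAdj' G C) (corClass-new i) (corClass-new j)
    }

  triangle-Extension : Extension (adj G) triangleAtt (triAdj G C)
  triangle-Extension = record
    { old-old = λ u v → cong₂ (triAdj' G C) (triClass-old u) (triClass-old v)
    ; old-new = λ u i → cong₂ (triAdj' G C) (triClass-old u) (triClass-new i)
    ; new-old = λ i v → cong₂ (triAdj' G C) (triClass-new i) (triClass-old v)
    ; new-new = λ i j → cong₂ (triAdj' G C) (triClass-new i) (triClass-new j)
    }

  coronaFree : Subset (n G) → Fin (c + c) → Bool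
  coronaFree S j = not (lookup S (vtx C (pendantOf j)))

  triangleFree : Subset (n G) → Fin c → Bool
  triangleFree S i = not (lookup S (vtx C i)) ∧ not (lookup S (vtx C (next i)))

  coronaFree-⇔ : ∀ S j → coronaFree S j ≡ true ⇔ Avoids S (coronaAtt j)
  coronaFree-⇔ S j = avoids-vertex S (vtx C (pendantOf j))

  triangleFree-⇔ : ∀ S i → triangleFree S i ≡ true ⇔ Avoids S (triangleAtt i)
  triangleFree-⇔ S i = ⇔-trans ∧-⇔ (⇔-trans (avoids-vertex S (vtx C i) ×-⇔ avoids-vertex S (vtx C (next i)))
                                             (⇔-sym (avoids-∨ S _ _)))

  not-both-ends : ∀ S → Independent (adj G) S → ∀ i → lookup S (vtx C i) ∧ lookup S (vtx C (next i)) ≡ false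
  not-both-ends S indep i with lookup S (vtx C i) in u∈S | lookup S (vtx C (next i)) in v∈S
  ... | false | _     = refl
  ... | true  | false = refl
  ... | true  | true  = trans (sym (edges C i)) (indep _ u∈S _ v∈S)

  -- Counting free vertices around the cycle: with out = #(cycle vertices
  -- outside S), the corona has 2·out free pendants, and since every edge has
  -- an end outside S, 2·out = |C| + #(edges with both ends outside S).
  free-count : ∀ S → Independent (adj G) S → count (coronaFree S) ≡ c + count (triangleFree S)
  free-count S indep = begin
    count (coronaFree S)
      ≡⟨ ∑-++ c c (bit ∘ coronaFree S) ⟩
    ∑ (bit ∘ coronaFree S ∘ (_↑ˡ c)) + ∑ (bit ∘ coronaFree S ∘ (c ↑ʳ_))
      ≡⟨ cong₂ _+_ (sum-cong-≗ (cong outside ∘ pendantOf-↑ˡ)) (sum-cong-≗ (cong outside ∘ pendantOf-↑ʳ)) ⟩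
    ∑ outside + ∑ outside
      ≡⟨ cong (∑ outside +_) (∑-rotate c (len≥3 C) outside) ⟨
    ∑ outside + ∑ (outside ∘ next)
      ≡⟨ ∑-distrib-+ outside (outside ∘ next) ⟨
    ∑ (λ i → outside i + outside (next i))
      ≡⟨ sum-cong-≗ (λ i → bit-not-pair (lookup S (vtx C i)) (lookup S (vtx C (next i))) (not-both-ends S indep i)) ⟩
    ∑ (λ i → 1 + bit (triangleFree S i))
      ≡⟨ ∑-distrib-+ (λ _ → 1) (bit ∘ triangleFree S) ⟩
    ∑ {c} (λ _ → 1) + count (triangleFree S)
      ≡⟨ cong (_+ count (triangleFree S)) (∑-ones c) ⟩
    c + count (triangleFree S)
      ∎
    where
    open ≡-Reasoning
    outside : Fin c → ℕ
    outside i = bit (not (lookup S (vtx C i)))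

  corona-indepSizes : indepSizes (corAdj G C) ≈ binom c ⊗ indepSizes (triAdj G C)
  corona-indepSizes = begin
    indepSizes (corAdj G C)                         ≈⟨ indepSizes-extension corona-Extension coronaFree coronaFree-⇔ ⟩
    extSizes (adj G) (count ∘ coronaFree)           ≈⟨ extSizes-factor (adj G) _ _ c free-count ⟩
    binom c ⊗ extSizes (adj G) (count ∘ triangleFree) ≈⟨ ⊗-cong (≈-refl {binom c}) (indepSizes-extension triangle-Extension triangleFree triangleFree-⇔) ⟨
    binom c ⊗ indepSizes (triAdj G C)               ∎
    where open SetoidReasoning ≈-setoid

corollary4 : (G : Graph) (C : Cycle G) (k : ℕ) →
    ICorona G C k ≡ ((onePlusX ^ₚ len C) *ₚ ITriangle G C) k
corollary4 G C k = begin
  ICorona G C k                                                      ≡⟨ IndPoly-indepSizes (corNum G C) (corAdj G C) k ⟩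
  poly (indepSizes (corAdj G C)) k                                   ≡⟨ coeff (corona-indepSizes G C) k ⟩
  poly (binom (len C) ⊗ indepSizes (triAdj G C)) k                   ≡⟨ poly-⊗ (binom (len C)) (indepSizes (triAdj G C)) k ⟩
  (poly (binom (len C)) *ₚ poly (indepSizes (triAdj G C))) k         ≡⟨ *ₚ-cong (poly-binom (len C)) (λ i → sym (IndPoly-indepSizes (triNum G C) (triAdj G C) i)) k ⟩
  ((onePlusX ^ₚ len C) *ₚ ITriangle G C) k                           ∎
  where open ≡-Reasoning
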